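{- For all $n\ge1$, $x^{n+1}Q_{n,132}^{(0,0,\emptyset,0)}\!\left(\frac1x\right)=Q_{n,132}^{(0,0,\emptyset,0)}(x)$.
   Context: For $\sigma=\sigma_1\cdots\sigma_n\in S_n$, $\mathrm{mmp}^{(0,0,\emptyset,0)}(\sigma)$ is the number of positions $i$ such that there is no $j<i$ with $\sigma_j<\sigma_i$ (the number of left-to-right minima). $S_n(132)$ is the set of 132-avoiding permutations of $[n]$. $Q_{n,132}^{(0,0,\emptyset,0)}(x)=\sum_{\sigma\in S_n(132)}x^{\mathrm{mmp}^{(0,0,\emptyset,0)}(\sigma)}$. -}

module Defs where

open import Data.Bool using (Bool; true; false; not; _∧_; _∨_; if_then_else_)
open import Data.Nat using (ℕ; zero; suc; _+_; _<ᵇ_; _≡ᵇ_)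
open import Data.List using (List; []; _∷_; [_]; map; concatMap; length; filterᵇ; upTo)
open import Data.Bool.ListAction using (any)

-- Permutations of [n] are encoded as words σ = σ₁⋯σₙ over {0,…,n-1}
-- (values shifted down by one; only relative order matters) with distinct letters.

words : ℕ → ℕ → List (List ℕ)
words zero    m = [ [] ]
words (suc n) m = concatMap (λ w → map (_∷ w) (upTo m)) (words n m)

distinct : List ℕ → Bool
distinct []       = true
distinct (x ∷ xs) = not (any (x ≡ᵇ_) xs) ∧ distinct xs

isPerm : ℕ → List ℕ → Bool
isPerm n σ = (length σ ≡ᵇ n) ∧ distinct σ

has21above : ℕ → List ℕ → Bool
has21above a []       = false
has21above a (b ∷ ys) = any (λ c → (a <ᵇ c) ∧ (c <ᵇ b)) ys ∨ has21above a ys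

contains132 : List ℕ → Bool
contains132 []       = false
contains132 (a ∷ xs) = has21above a xs ∨ contains132 xs

lrminAux : List ℕ → List ℕ → ℕ
lrminAux seen []       = 0
lrminAux seen (x ∷ xs) = (if any (_<ᵇ x) seen then 0 else 1) + lrminAux (x ∷ seen) xs

mmp : List ℕ → ℕ
mmp σ = lrminAux [] σ

-- coefficient of x^k in Q_{n,132}^{(0,0,∅,0)}(x):
-- #{σ ∈ S_n(132) : mmp(σ) = k}
coeffQ : ℕ → ℕ → ℕ
coeffQ n k = length (filterᵇ (λ σ → isPerm n σ ∧ not (contains132 σ) ∧ (mmp σ ≡ᵇ k)) (words n n))

module Submission where

-- A 132-avoiding arrangement of [o, o+n) with n ≥ 1 has the form α M β
-- where M = o+n-1 is its maximum, every letter of α exceeds every letter of β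
-- (otherwise a < b < M with a in α, b in β is a 132), and α, β are again
-- 132-avoiding arrangements of the top and bottom part of the interval.
-- Recursively this is a bijection between binary trees with n internal nodes and
-- S_n(132) (the map 'decode'); under it the left-to-right minima of the word are
-- the nodes whose left subtree is a leaf ('leftLeaves').  Mirroring the tree
-- exchanges left and right leaves, and a tree with n ≥ 1 nodes has n + 1 leaves,
-- each a left or a right child; so mirroring sends k left leaves to n + 1 - k.

open import Defs
open import Data.Bool using (Bool; true; false; not; _∧_; _∨_; if_then_else_; T)
open import Data.Bool.Properties using (∨-conicalˡ; ∨-conicalʳ; ∨-zeroʳ; T-≡; T-∧; T-not-≡)
open import Data.Bool.ListAction using (any)
open import Data.Empty using (⊥; ⊥-elim)
open import Data.List
  using (List; []; _∷_; [_]; _++_; map; length; filterᵇ; applyUpTo; upTo; concatMap;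
         cartesianProductWith; reverseAcc)
open import Data.List.Properties
  using (length-map; length-++; length-++-sucʳ; length-applyUpTo; ∷-injective; ++-conicalʳ)
open import Data.List.Membership.Propositional using (_∈_)
open import Data.List.Membership.Propositional.Properties
  using (∈-++⁺ˡ; ∈-++⁺ʳ; ∈-++⁻; ∈-∃++; ∈-map⁺; ∈-map⁻; ∈-filter⁺; ∈-filter⁻;
         ∈-applyUpTo⁺; ∈-applyUpTo⁻; ∈-upTo⁺; ∈-upTo⁻;
         ∈-cartesianProductWith⁺; ∈-cartesianProductWith⁻)
open import Data.List.Relation.Binary.Disjoint.Propositional using (Disjoint)
open import Data.List.Relation.Binary.Subset.Propositional using (_⊆_)
open import Data.List.Relation.Unary.All as All using ()
open import Data.List.Relation.Unary.All.Properties using (¬Any⇒All¬)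
open import Data.List.Relation.Unary.AllPairs using ([]; _∷_)
open import Data.List.Relation.Unary.Any using (here; there)
open import Data.List.Relation.Unary.Any.Properties using (reverseAcc⁺; reverseAcc⁻)
open import Data.List.Relation.Unary.Unique.Propositional using (Unique)
open import Data.List.Relation.Unary.Unique.Propositional.Properties
  using (map⁺; filter⁺; ++⁺; applyUpTo⁺₁; upTo⁺; cartesianProductWith⁺)
open import Data.Nat using (ℕ; zero; suc; _+_; _∸_; _≤_; _<_; z≤n; s≤s; _<ᵇ_; _≡ᵇ_; _≟_; _<?_)
open import Data.Nat.Properties
open import Data.Nat.Tactic.RingSolver using (solve-∀)
open import Data.Product using (_×_; _,_; proj₁; proj₂; ∃-syntax; uncurry; swap)
open import Data.Sum using (inj₁; inj₂)
open import Data.Unit using (tt)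
open import Function using (_∘_)
open import Function.Bundles using (Equivalence)
open import Relation.Nullary using (¬_; yes; no; contradiction)
open import Relation.Nullary.Decidable using (T?)
open import Relation.Binary.PropositionalEquality
  using (_≡_; _≢_; refl; sym; trans; cong; cong₂; subst; subst₂; module ≡-Reasoning)
open import Data.List.Membership.DecPropositional _≟_ using (_∈?_)

open ≡-Reasoning

unique-++⁻ : ∀ {A : Set} (xs : List A) {ys} → Unique (xs ++ ys) →
             Unique xs × Unique ys × Disjoint xs ys
unique-++⁻ []       u          = [] , u , λ ()
unique-++⁻ (x ∷ xs) (x∉ ∷ u) with unique-++⁻ xs u
... | uxs , uys , disjoint = All.tabulate (λ y∈ → All.lookup x∉ (∈-++⁺ˡ y∈)) ∷ uxs , uys , apart
  where
  apart : Disjoint (x ∷ xs) _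
  apart (here refl  , x∈ys) = All.lookup x∉ (∈-++⁺ʳ xs x∈ys) refl
  apart (there v∈xs , v∈ys) = disjoint (v∈xs , v∈ys)

∈-delete : ∀ {A : Set} {x v : A} as {bs} → x ∈ as ++ v ∷ bs → x ≢ v → x ∈ as ++ bs
∈-delete as x∈ x≢v with ∈-++⁻ as x∈
... | inj₁ x∈as         = ∈-++⁺ˡ x∈as
... | inj₂ (here x≡v)   = contradiction x≡v x≢v
... | inj₂ (there x∈bs) = ∈-++⁺ʳ as x∈bs

unique⊆⇒length≤ : ∀ {A : Set} {xs ys : List A} → Unique xs → xs ⊆ ys → length xs ≤ length ys
unique⊆⇒length≤ {xs = []}     _           _   = z≤n
unique⊆⇒length≤ {xs = x ∷ xs} (x∉xs ∷ u) sub with ∈-∃++ (sub (here refl))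
... | as , bs , refl =
  subst (suc (length xs) ≤_) (sym (length-++-sucʳ as x bs)) (s≤s (unique⊆⇒length≤ u shrink))
  where
  shrink : xs ⊆ as ++ bs
  shrink y∈ = ∈-delete as (sub (there y∈)) (λ y≡x → All.lookup x∉xs y∈ (sym y≡x))

sameMembers⇒length≡ : ∀ {A : Set} {xs ys : List A} → Unique xs → Unique ys →
                      xs ⊆ ys → ys ⊆ xs → length xs ≡ length ys
sameMembers⇒length≡ uxs uys xs⊆ys ys⊆xs =
  ≤-antisym (unique⊆⇒length≤ uxs xs⊆ys) (unique⊆⇒length≤ uys ys⊆xs)

count-bijection : ∀ {A B : Set} (f : A → B) {p : A → Bool} {q : B → Bool} {xs : List A} {ys : List B} →
  (∀ {x y} → f x ≡ f y → x ≡ y) → Unique xs → Unique ys →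
  (∀ {x} → x ∈ xs → T (p x) → f x ∈ ys × T (q (f x))) →
  (∀ {y} → y ∈ ys → T (q y) → ∃[ x ] (x ∈ xs × T (p x) × f x ≡ y)) →
  length (filterᵇ p xs) ≡ length (filterᵇ q ys)
count-bijection f {p} {q} {xs} {ys} inj uxs uys into onto = begin
  length (filterᵇ p xs)         ≡⟨ sym (length-map f (filterᵇ p xs)) ⟩
  length (map f (filterᵇ p xs)) ≡⟨ sameMembers⇒length≡ (map⁺ inj (filter⁺ _ uxs)) (filter⁺ _ uys) image⊆ ⊆image ⟩
  length (filterᵇ q ys)         ∎
  where
  image⊆ : map f (filterᵇ p xs) ⊆ filterᵇ q ys
  image⊆ y∈ with ∈-map⁻ f y∈
  ... | x , x∈ , refl with ∈-filter⁻ (T? ∘ p) {xs = xs} x∈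
  ...   | x∈xs , px = uncurry (∈-filter⁺ (T? ∘ q)) (into x∈xs px)
  ⊆image : filterᵇ q ys ⊆ map f (filterᵇ p xs)
  ⊆image y∈ with ∈-filter⁻ (T? ∘ q) {xs = ys} y∈
  ... | y∈ys , qy with onto y∈ys qy
  ...   | x , x∈xs , px , refl = ∈-map⁺ f (∈-filter⁺ (T? ∘ p) x∈xs px)

InRange : ℕ → ℕ → List ℕ → Set
InRange o n w = ∀ {x} → x ∈ w → o ≤ x × x < o + n

record Arrangement (o n : ℕ) (w : List ℕ) : Set where
  field
    length≡ : length w ≡ n
    unique  : Unique w
    inRange : InRange o n w

interval : ℕ → ℕ → List ℕ
interval o n = applyUpTo (o +_) n

interval-unique : ∀ o n → Unique (interval o n)
interval-unique o n = applyUpTo⁺₁ (o +_) n (λ i<j _ o+i≡o+j → <⇒≢ i<j (+-cancelˡ-≡ o _ _ o+i≡o+j))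

∈-interval⁺ : ∀ {o n v} → o ≤ v → v < o + n → v ∈ interval o n
∈-interval⁺ {o} {n} {v} o≤v v<o+n =
  subst (_∈ interval o n) (m+[n∸m]≡n o≤v)
        (∈-applyUpTo⁺ (o +_) (+-cancelˡ-< o _ _ (subst (_< o + n) (sym (m+[n∸m]≡n o≤v)) v<o+n)))

∈-interval⁻ : ∀ {o n v} → v ∈ interval o n → o ≤ v × v < o + n
∈-interval⁻ {o} v∈ with ∈-applyUpTo⁻ (o +_) v∈
... | i , i<n , refl = m≤m+n o i , +-monoʳ-< o i<n

arrangement-covers : ∀ {o n w v} → Arrangement o n w → o ≤ v → v < o + n → v ∈ w
arrangement-covers {o} {n} {w} {v} arr o≤v v<o+n with v ∈? w
... | yes v∈w = v∈w
... | no  v∉w = contradiction too-long 1+n≰n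
  where
  open Arrangement arr
  v∷w⊆ : v ∷ w ⊆ interval o n
  v∷w⊆ (here refl) = ∈-interval⁺ o≤v v<o+n
  v∷w⊆ (there x∈w) = uncurry ∈-interval⁺ (inRange x∈w)
  too-long : suc n ≤ n
  too-long = subst₂ _≤_ (cong suc length≡) (length-applyUpTo (o +_) n)
                    (unique⊆⇒length≤ (¬Any⇒All¬ w v∉w ∷ unique) v∷w⊆)

refute : ∀ {b : Bool} {P : Set} → (T b → P) → ¬ P → b ≡ false
refute {false} _     _  = refl
refute {true}  sound ¬p = contradiction (sound tt) ¬p

<ᵇ-true : ∀ {m n} → m < n → (m <ᵇ n) ≡ true
<ᵇ-true m<n = Equivalence.to T-≡ (<⇒<ᵇ m<n)

<ᵇ-false : ∀ {m n} → n ≤ m → (m <ᵇ n) ≡ false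
<ᵇ-false {m} {n} n≤m = refute (<ᵇ⇒< m n) (≤⇒≯ n≤m)

between-true : ∀ {a b c} → a < c → c < b → ((a <ᵇ c) ∧ (c <ᵇ b)) ≡ true
between-true a<c c<b = cong₂ _∧_ (<ᵇ-true a<c) (<ᵇ-true c<b)

between-false : ∀ {a b c} → (a < c → c < b → ⊥) → ((a <ᵇ c) ∧ (c <ᵇ b)) ≡ false
between-false {a} {b} {c} ¬between = refute witness (uncurry ¬between)
  where
  witness : T ((a <ᵇ c) ∧ (c <ᵇ b)) → a < c × c < b
  witness t with Equivalence.to T-∧ t
  ... | ta , tb = <ᵇ⇒< a c ta , <ᵇ⇒< c b tb

any-false⁺ : ∀ {A : Set} (p : A → Bool) xs → (∀ {x} → x ∈ xs → p x ≡ false) → any p xs ≡ false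
any-false⁺ p []       _     = refl
any-false⁺ p (x ∷ xs) fails = cong₂ _∨_ (fails (here refl)) (any-false⁺ p xs (fails ∘ there))

any-false⁻ : ∀ {A : Set} {p : A → Bool} {xs x} → any p xs ≡ false → x ∈ xs → p x ≡ false
any-false⁻ {xs = y ∷ ys} h (here refl) = ∨-conicalˡ _ _ h
any-false⁻ {p = p} {xs = y ∷ ys} h (there x∈) = any-false⁻ (∨-conicalʳ (p y) _ h) x∈

any-true : ∀ {A : Set} {p : A → Bool} {xs x} → x ∈ xs → p x ≡ true → any p xs ≡ true
any-true {p = p} {xs = y ∷ ys} (here refl) px = cong (_∨ any p ys) px
any-true {p = p} {xs = y ∷ ys} (there x∈) px = trans (cong (p y ∨_) (any-true x∈ px)) (∨-zeroʳ (p y))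

Avoids132 : List ℕ → Set
Avoids132 σ = contains132 σ ≡ false

has21above-bounded : ∀ a ys → (∀ {c} → c ∈ ys → c ≤ a) → has21above a ys ≡ false
has21above-bounded a []       _     = refl
has21above-bounded a (b ∷ ys) below =
  cong₂ _∨_ (any-false⁺ _ ys (λ c∈ → between-false {b = b} (λ a<c _ → <⇒≱ a<c (below (there c∈)))))
            (has21above-bounded a ys (below ∘ there))

has21above-++⁺ : ∀ a xs ys → has21above a xs ≡ false → has21above a ys ≡ false →
  (∀ {b c} → b ∈ xs → c ∈ ys → a < c → c < b → ⊥) → has21above a (xs ++ ys) ≡ false
has21above-++⁺ a []       ys _  none-ys _        = none-ys
has21above-++⁺ a (b ∷ xs) ys hx none-ys straddle =
  cong₂ _∨_ (any-false⁺ _ (xs ++ ys) first-letter)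
            (has21above-++⁺ a xs ys (∨-conicalʳ _ _ hx) none-ys (straddle ∘ there))
  where
  first-letter : ∀ {c} → c ∈ xs ++ ys → ((a <ᵇ c) ∧ (c <ᵇ b)) ≡ false
  first-letter c∈ with ∈-++⁻ xs c∈
  ... | inj₁ c∈xs = any-false⁻ (∨-conicalˡ _ _ hx) c∈xs
  ... | inj₂ c∈ys = between-false (straddle (here refl) c∈ys)

has21above-++⁻ : ∀ a xs {ys} → has21above a (xs ++ ys) ≡ false →
                 has21above a xs ≡ false × has21above a ys ≡ false
has21above-++⁻ a []       h = refl , h
has21above-++⁻ a (b ∷ xs) h with has21above-++⁻ a xs (∨-conicalʳ _ _ h)
... | hx , hy = cong₂ _∨_ (any-false⁺ _ xs (any-false⁻ (∨-conicalˡ _ _ h) ∘ ∈-++⁺ˡ)) hx , hy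

avoids-++⁻ : ∀ xs {ys} → Avoids132 (xs ++ ys) → Avoids132 xs × Avoids132 ys
avoids-++⁻ []       av = refl , av
avoids-++⁻ (a ∷ xs) av with avoids-++⁻ xs (∨-conicalʳ _ _ av)
... | av-xs , av-ys = cong₂ _∨_ (proj₁ (has21above-++⁻ a xs (∨-conicalˡ _ _ av))) av-xs , av-ys

avoids-no-cross : ∀ α M β {a b} → Avoids132 (α ++ M ∷ β) → a ∈ α → b ∈ β → a < b → b < M → ⊥
avoids-no-cross (x ∷ α) M β {b = b} av (here refl) b∈ a<b b<M = true≢false (trans (sym (between-true a<b b<M)) fails)
  where
  fails : ((x <ᵇ b) ∧ (b <ᵇ M)) ≡ false
  fails = any-false⁻ (∨-conicalˡ _ _ (proj₂ (has21above-++⁻ x α (∨-conicalˡ _ _ av)))) b∈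
  true≢false : true ≢ false
  true≢false ()
avoids-no-cross (x ∷ α) M β av (there a∈) b∈ a<b b<M =
  avoids-no-cross α M β (∨-conicalʳ _ _ av) a∈ b∈ a<b b<M

avoids-glue : ∀ α M β → Avoids132 α → Avoids132 β →
  (∀ {a} → a ∈ α → a < M) → (∀ {b} → b ∈ β → b < M) → (∀ {a b} → a ∈ α → b ∈ β → b < a) →
  Avoids132 (α ++ M ∷ β)
avoids-glue [] M β _ av-β _ β<M _ =
  cong₂ _∨_ (has21above-bounded M β (<⇒≤ ∘ β<M)) av-β
avoids-glue (a ∷ α) M β av-α av-β α<M β<M above =
  cong₂ _∨_ (has21above-++⁺ a α (M ∷ β) (∨-conicalˡ _ _ av-α) none-after-M straddle)
            (avoids-glue α M β (∨-conicalʳ _ _ av-α) av-β (α<M ∘ there) β<M (above ∘ there))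
  where
  β<a : ∀ {c} → c ∈ β → c < a
  β<a = above (here refl)
  none-after-M : has21above a (M ∷ β) ≡ false
  none-after-M = cong₂ _∨_ (any-false⁺ _ β (λ c∈ → between-false {b = M} (λ a<c _ → <-asym a<c (β<a c∈))))
                           (has21above-bounded a β (<⇒≤ ∘ β<a))
  straddle : ∀ {b c} → b ∈ α → c ∈ M ∷ β → a < c → c < b → ⊥
  straddle b∈ (here refl) _   M<b = <-asym M<b (α<M (there b∈))
  straddle b∈ (there c∈)  a<c _   = <-asym a<c (β<a c∈)

newMinFlag : List ℕ → ℕ → ℕ
newMinFlag seen x = if any (_<ᵇ x) seen then 0 else 1

lrmin-++ : ∀ seen xs ys →
  lrminAux seen (xs ++ ys) ≡ lrminAux seen xs + lrminAux (reverseAcc seen xs) ys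
lrmin-++ seen []       ys = refl
lrmin-++ seen (x ∷ xs) ys =
  trans (cong (newMinFlag seen x +_) (lrmin-++ (x ∷ seen) xs ys))
        (sym (+-assoc (newMinFlag seen x) (lrminAux (x ∷ seen) xs) (lrminAux (reverseAcc (x ∷ seen) xs) ys)))

lrmin-seen-cong : ∀ s₁ s₂ xs → (∀ {y} → y ∈ xs → any (_<ᵇ y) s₁ ≡ any (_<ᵇ y) s₂) →
                  lrminAux s₁ xs ≡ lrminAux s₂ xs
lrmin-seen-cong s₁ s₂ []       _    = refl
lrmin-seen-cong s₁ s₂ (x ∷ xs) same =
  cong₂ _+_ (cong (λ b → if b then 0 else 1) (same (here refl)))
            (lrmin-seen-cong (x ∷ s₁) (x ∷ s₂) xs (λ y∈ → cong (_ ∨_) (same (there y∈))))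

lrmin-seen-above : ∀ s xs → (∀ {z y} → z ∈ s → y ∈ xs → y < z) → lrminAux s xs ≡ lrminAux [] xs
lrmin-seen-above s xs above =
  lrmin-seen-cong s [] xs (λ y∈ → any-false⁺ _ s (λ z∈ → <ᵇ-false (<⇒≤ (above z∈ y∈))))

data Tree : Set where
  leaf : Tree
  node : Tree → Tree → Tree

size : Tree → ℕ
size leaf       = 0
size (node l r) = suc (size l + size r)

leafFlag : Tree → ℕ
leafFlag leaf         = 1
leafFlag (node _ _)   = 0

leftLeaves : Tree → ℕ
leftLeaves leaf       = 0
leftLeaves (node l r) = leafFlag l + leftLeaves l + leftLeaves r

decode : Tree → ℕ → List ℕ
decode leaf       o = []
decode (node l r) o = decode l (o + size r) ++ (o + size r + size l) ∷ decode r o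

below-top : ∀ o l r {x} → x ≤ o + size r + size l → x < o + size (node l r)
below-top o l r {x} x≤root = subst (x <_) (sym top) (s≤s x≤root)
  where
  top : o + size (node l r) ≡ suc (o + size r + size l)
  top = trans (+-suc o _) (cong suc (trans (cong (o +_) (+-comm (size l) (size r)))
                                           (sym (+-assoc o (size r) (size l)))))

decode-inRange : ∀ t o → InRange o (size t) (decode t o)
decode-inRange leaf       o ()
decode-inRange (node l r) o x∈ with ∈-++⁻ (decode l (o + size r)) x∈
... | inj₁ x∈l with decode-inRange l (o + size r) x∈l
...   | lo , hi = ≤-trans (m≤m+n o (size r)) lo , below-top o l r (<⇒≤ hi)
decode-inRange (node l r) o x∈ | inj₂ (here refl) =
  ≤-trans (m≤m+n o (size r)) (m≤m+n _ (size l)) , below-top o l r ≤-refl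
decode-inRange (node l r) o x∈ | inj₂ (there x∈r) with decode-inRange r o x∈r
... | lo , hi = lo , below-top o l r (≤-trans (<⇒≤ hi) (m≤m+n _ (size l)))

decode-length : ∀ t o → length (decode t o) ≡ size t
decode-length leaf       o = refl
decode-length (node l r) o = begin
  length (decode l (o + size r) ++ _ ∷ decode r o) ≡⟨ length-++-sucʳ (decode l _) _ (decode r o) ⟩
  suc (length (decode l (o + size r) ++ decode r o)) ≡⟨ cong suc (length-++ (decode l _)) ⟩
  suc (length (decode l (o + size r)) + length (decode r o))
    ≡⟨ cong suc (cong₂ _+_ (decode-length l _) (decode-length r o)) ⟩
  size (node l r) ∎

decode-unique : ∀ t o → Unique (decode t o)
decode-unique leaf       o = []
decode-unique (node l r) o =
  ++⁺ (decode-unique l _) (All.tabulate root∉r ∷ decode-unique r o) upper-vs-rest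
  where
  root∉r : ∀ {b} → b ∈ decode r o → o + size r + size l ≢ b
  root∉r b∈ refl = n≮n _ (≤-trans (proj₂ (decode-inRange r o b∈)) (m≤m+n _ (size l)))
  upper-vs-rest : Disjoint (decode l (o + size r)) (o + size r + size l ∷ decode r o)
  upper-vs-rest (v∈l , here refl)  = n≮n _ (proj₂ (decode-inRange l _ v∈l))
  upper-vs-rest (v∈l , there v∈r) =
    n≮n _ (≤-trans (proj₂ (decode-inRange r o v∈r)) (proj₁ (decode-inRange l _ v∈l)))

decode-arrangement : ∀ t o → Arrangement o (size t) (decode t o)
decode-arrangement t o = record
  { length≡ = decode-length t o ; unique = decode-unique t o ; inRange = decode-inRange t o }

decode-avoids : ∀ t o → Avoids132 (decode t o)
decode-avoids leaf       o = refl
decode-avoids (node l r) o =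
  avoids-glue (decode l _) _ (decode r o) (decode-avoids l _) (decode-avoids r o)
    (λ a∈ → proj₂ (decode-inRange l _ a∈))
    (λ b∈ → ≤-trans (proj₂ (decode-inRange r o b∈)) (m≤m+n _ (size l)))
    (λ a∈ b∈ → ≤-trans (proj₂ (decode-inRange r o b∈)) (proj₁ (decode-inRange l _ a∈)))

root-newMin : ∀ l p M → (∀ {x} → x ∈ decode l p → x < M) →
              newMinFlag (reverseAcc [] (decode l p)) M ≡ leafFlag l
root-newMin leaf         p M _     = refl
root-newMin (node l₁ l₂) p M below =
  cong (λ b → if b then 0 else 1) (any-true (reverseAcc⁺ [] (decode (node l₁ l₂) p) (inj₂ root∈))
                                            (<ᵇ-true (below root∈)))
  where
  root∈ : p + size l₂ + size l₁ ∈ decode (node l₁ l₂) p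
  root∈ = ∈-++⁺ʳ (decode l₁ _) (here refl)

lrmin-decode : ∀ t o → lrminAux [] (decode t o) ≡ leftLeaves t
lrmin-decode leaf       o = refl
lrmin-decode (node l r) o = begin
  lrminAux [] (A ++ M ∷ B)
    ≡⟨ lrmin-++ [] A (M ∷ B) ⟩
  lrminAux [] A + (newMinFlag (reverseAcc [] A) M + lrminAux (M ∷ reverseAcc [] A) B)
    ≡⟨ cong₂ _+_ (lrmin-decode l _)
                 (cong₂ _+_ (root-newMin l _ M (λ x∈ → proj₂ (decode-inRange l _ x∈)))
                            (lrmin-seen-above (M ∷ reverseAcc [] A) B seen-above)) ⟩
  leftLeaves l + (leafFlag l + lrminAux [] B)
    ≡⟨ cong (λ z → leftLeaves l + (leafFlag l + z)) (lrmin-decode r o) ⟩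
  leftLeaves l + (leafFlag l + leftLeaves r)
    ≡⟨ sym (+-assoc (leftLeaves l) (leafFlag l) (leftLeaves r)) ⟩
  leftLeaves l + leafFlag l + leftLeaves r
    ≡⟨ cong (_+ leftLeaves r) (+-comm (leftLeaves l) (leafFlag l)) ⟩
  leftLeaves (node l r) ∎
  where
  A : List ℕ
  A = decode l (o + size r)
  M : ℕ
  M = o + size r + size l
  B : List ℕ
  B = decode r o
  seen-above : ∀ {z y} → z ∈ M ∷ reverseAcc [] A → y ∈ B → y < z
  seen-above (here refl) y∈ = ≤-trans (proj₂ (decode-inRange r o y∈)) (m≤m+n _ (size l))
  seen-above (there z∈)  y∈ with reverseAcc⁻ [] A z∈
  ... | inj₂ z∈A = ≤-trans (proj₂ (decode-inRange r o y∈)) (proj₁ (decode-inRange l _ z∈A))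

split-at-bound : ∀ {M : ℕ} as as' {bs bs'} → (∀ {x} → x ∈ as → x < M) → (∀ {x} → x ∈ as' → x < M) →
                 as ++ M ∷ bs ≡ as' ++ M ∷ bs' → as ≡ as' × bs ≡ bs'
split-at-bound []       []         _ _  refl = refl , refl
split-at-bound []       (x' ∷ as') _ b' refl = contradiction (b' (here refl)) (n≮n _)
split-at-bound (x ∷ as) []         b _  refl = contradiction (b (here refl)) (n≮n _)
split-at-bound (x ∷ as) (x' ∷ as') b b' eq with ∷-injective eq
... | refl , eq′ with split-at-bound as as' (b ∘ there) (b' ∘ there) eq′
...   | refl , refl = refl , refl

-- decode is injective: the root letter is the maximum, which fixes the two blocks.
decode-injective : ∀ t t' o → decode t o ≡ decode t' o → t ≡ t'
decode-injective leaf       leaf         o _  = refl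
decode-injective leaf       (node l' r') o eq with () ← ++-conicalʳ (decode l' _) _ (sym eq)
decode-injective (node l r) leaf         o eq with () ← ++-conicalʳ (decode l _) _ eq
decode-injective (node l r) (node l' r') o eq =
  cong₂ node (decode-injective l l' (o + size r) (trans upper≡ (cong (λ s → decode l' (o + s)) (sym r≡r'))))
             (decode-injective r r' o lower≡)
  where
  root : ∀ l r → o + size r + size l ≡ o + (size l + size r)
  root l r = trans (+-assoc o (size r) (size l)) (cong (o +_) (+-comm (size r) (size l)))
  sizes : size l + size r ≡ size l' + size r'
  sizes = suc-injective (trans (sym (decode-length (node l r) o))
                               (trans (cong length eq) (decode-length (node l' r') o)))
  root≡ : o + size r + size l ≡ o + size r' + size l'
  root≡ = trans (root l r) (trans (cong (o +_) sizes) (sym (root l' r')))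
  parts : decode l (o + size r) ≡ decode l' (o + size r') × decode r o ≡ decode r' o
  parts = split-at-bound (decode l _) (decode l' _)
            (λ x∈ → proj₂ (decode-inRange l _ x∈))
            (λ {x} x∈ → subst (x <_) (sym root≡) (proj₂ (decode-inRange l' _ x∈)))
            (trans eq (cong (λ m → decode l' (o + size r') ++ m ∷ decode r' o) (sym root≡)))
  upper≡ : decode l (o + size r) ≡ decode l' (o + size r')
  upper≡ = proj₁ parts
  lower≡ : decode r o ≡ decode r' o
  lower≡ = proj₂ parts
  l≡l' : size l ≡ size l'
  l≡l' = trans (sym (decode-length l _)) (trans (cong length upper≡) (decode-length l' _))
  r≡r' : size r ≡ size r'
  r≡r' = +-cancelˡ-≡ (size l) (size r) (size r') (trans sizes (cong (_+ size r') (sym l≡l')))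

module SplitAtMax {o m : ℕ} (α β : List ℕ) (arr : Arrangement o (suc m) (α ++ (o + m) ∷ β)) where
  open Arrangement arr

  pieces : Unique α × Unique ((o + m) ∷ β) × Disjoint α ((o + m) ∷ β)
  pieces = unique-++⁻ α unique

  α-unique : Unique α
  α-unique = proj₁ pieces

  β-unique : Unique β
  β-unique with proj₁ (proj₂ pieces)
  ... | _ ∷ u = u

  block-lengths : length α + length β ≡ m
  block-lengths = suc-injective (trans (sym (trans (length-++-sucʳ α (o + m) β) (cong suc (length-++ α))))
                                       length≡)

  max-split : o + m ≡ o + length β + length α
  max-split = trans (cong (o +_) (trans (sym block-lengths) (+-comm (length α) (length β))))
                    (sym (+-assoc o (length β) (length α)))

  below-max : ∀ {x} → x ∈ α ++ (o + m) ∷ β → x ≢ o + m → x < o + m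
  below-max {x} x∈ x≢M = ≤∧≢⇒< (≤-pred (subst (x <_) (+-suc o m) (proj₂ (inRange x∈)))) x≢M

  α-below : ∀ {a} → a ∈ α → a < o + m
  α-below a∈ = below-max (∈-++⁺ˡ a∈) (λ { refl → proj₂ (proj₂ pieces) (a∈ , here refl) })

  β-below : ∀ {b} → b ∈ β → b < o + m
  β-below b∈ with proj₁ (proj₂ pieces)
  ... | M∉β ∷ _ = below-max (∈-++⁺ʳ α (there b∈)) (λ { refl → All.lookup M∉β b∈ refl })

  inside : ∀ {x} → x < o + m → x < o + suc m
  inside {x} x<M = subst (x <_) (sym (+-suc o m)) (m<n⇒m<1+n x<M)

  blocks-ordered : Avoids132 (α ++ (o + m) ∷ β) → ∀ {a b} → a ∈ α → b ∈ β → b < a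
  blocks-ordered av {a} {b} a∈ b∈ with b <? a
  ... | yes b<a = b<a
  ... | no  b≮a = ⊥-elim (avoids-no-cross α (o + m) β av a∈ b∈ a<b (β-below b∈))
    where
    a<b : a < b
    a<b = ≤∧≢⇒< (≮⇒≥ b≮a) (λ { refl → proj₂ (proj₂ pieces) (a∈ , there b∈) })

  module _ (ordered : ∀ {a b} → a ∈ α → b ∈ β → b < a) where

    -- β is the bottom block: were some b ∈ β ≥ o + |β|, then all of o, …, o + |β|
    -- (each ≤ b, hence not in α and not M) would be among the |β| letters of β.
    β-low : ∀ {b} → b ∈ β → b < o + length β
    β-low {b} b∈ with b <? o + length β
    ... | yes b<top = b<top
    ... | no  b≮top = contradiction too-long 1+n≰n
      where
      fill : ∀ {v} → o ≤ v → v ≤ b → v ∈ β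
      fill {v} o≤v v≤b with ∈-++⁻ α (arrangement-covers arr o≤v (inside (≤-<-trans v≤b (β-below b∈))))
      ... | inj₁ v∈α         = contradiction (ordered v∈α b∈) (≤⇒≯ v≤b)
      ... | inj₂ (here refl) = contradiction (≤-<-trans v≤b (β-below b∈)) (n≮n _)
      ... | inj₂ (there v∈β) = v∈β
      fills : interval o (suc (length β)) ⊆ β
      fills {v} v∈ with ∈-interval⁻ v∈
      ... | o≤v , v<top =
        fill o≤v (≤-trans (≤-pred (subst (v <_) (+-suc o (length β)) v<top)) (≮⇒≥ b≮top))
      too-long : suc (length β) ≤ length β
      too-long = subst (_≤ length β) (length-applyUpTo (o +_) (suc (length β)))
                       (unique⊆⇒length≤ (interval-unique o (suc (length β))) fills)

    lower-block : Arrangement o (length β) β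
    lower-block = record
      { length≡ = refl
      ; unique  = β-unique
      ; inRange = λ b∈ → proj₁ (inRange (∈-++⁺ʳ α (there b∈))) , β-low b∈
      }

    -- α is the top block: a letter of α below o + |β| would also lie in β.
    α-high : ∀ {a} → a ∈ α → o + length β ≤ a
    α-high {a} a∈ with a <? o + length β
    ... | no  a≮low = ≮⇒≥ a≮low
    ... | yes a<low = ⊥-elim (proj₂ (proj₂ pieces)
            (a∈ , there (arrangement-covers lower-block (proj₁ (inRange (∈-++⁺ˡ a∈))) a<low)))

    upper-block : Arrangement (o + length β) (length α) α
    upper-block = record
      { length≡ = refl
      ; unique  = α-unique
      ; inRange = λ {a} a∈ → α-high a∈ , subst (a <_) max-split (α-below a∈)
      }

decode-node : ∀ {l r o α β} → decode l (o + length β) ≡ α → size l ≡ length α →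
              decode r o ≡ β → size r ≡ length β →
              decode (node l r) o ≡ α ++ (o + length β + length α) ∷ β
decode-node dl sl dr sr rewrite sr | sl | dl | dr = refl

-- Every 132-avoiding arrangement of [o, o + n) is decode t o for a tree t of size n.
-- (fuel ≥ n makes the recursion on the two blocks structural)
mutual
  encode : ∀ fuel n o w → n ≤ fuel → Arrangement o n w → Avoids132 w →
           ∃[ t ] (size t ≡ n × decode t o ≡ w)
  encode _          zero    o []      _            _   _  = leaf , refl , refl
  encode _          zero    o (_ ∷ _) _            arr _  with () ← Arrangement.length≡ arr
  encode (suc fuel) (suc m) o w       (s≤s m≤fuel) arr av
    with ∈-∃++ (arrangement-covers arr (m≤m+n o m) (+-monoʳ-< o ≤-refl))
  ... | α , β , refl = encode-split fuel m o α β m≤fuel arr av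

  encode-split : ∀ fuel m o α β → m ≤ fuel → Arrangement o (suc m) (α ++ (o + m) ∷ β) →
                 Avoids132 (α ++ (o + m) ∷ β) →
                 ∃[ t ] (size t ≡ suc m × decode t o ≡ α ++ (o + m) ∷ β)
  encode-split fuel m o α β m≤fuel arr av =
    join (encode fuel (length α) (o + length β) α α≤fuel (upper-block ordered) av-α)
         (encode fuel (length β) o β β≤fuel (lower-block ordered) (∨-conicalʳ _ _ av-Mβ))
    where
    open SplitAtMax α β arr
    ordered : ∀ {a b} → a ∈ α → b ∈ β → b < a
    ordered = blocks-ordered av
    av-α : Avoids132 α
    av-α = proj₁ (avoids-++⁻ α av)
    av-Mβ : Avoids132 ((o + m) ∷ β)
    av-Mβ = proj₂ (avoids-++⁻ α av)
    α≤fuel : length α ≤ fuel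
    α≤fuel = ≤-trans (subst (length α ≤_) block-lengths (m≤m+n _ _)) m≤fuel
    β≤fuel : length β ≤ fuel
    β≤fuel = ≤-trans (subst (length β ≤_) block-lengths (m≤n+m _ _)) m≤fuel
    join : ∃[ tα ] (size tα ≡ length α × decode tα (o + length β) ≡ α) →
           ∃[ tβ ] (size tβ ≡ length β × decode tβ o ≡ β) →
           ∃[ t ] (size t ≡ suc m × decode t o ≡ α ++ (o + m) ∷ β)
    join (tα , sα , dα) (tβ , sβ , dβ) =
      node tα tβ ,
      cong suc (trans (cong₂ _+_ sα sβ) block-lengths) ,
      trans (decode-node dα sα dβ sβ) (cong (λ M → α ++ M ∷ β) (sym max-split))

mirror : Tree → Tree
mirror leaf       = leaf
mirror (node l r) = node (mirror r) (mirror l)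

mirror-involutive : ∀ t → mirror (mirror t) ≡ t
mirror-involutive leaf       = refl
mirror-involutive (node l r) = cong₂ node (mirror-involutive l) (mirror-involutive r)

mirror-injective : ∀ {t t'} → mirror t ≡ mirror t' → t ≡ t'
mirror-injective {t} {t'} eq =
  trans (sym (mirror-involutive t)) (trans (cong mirror eq) (mirror-involutive t'))

size-mirror : ∀ t → size (mirror t) ≡ size t
size-mirror leaf       = refl
size-mirror (node l r) = cong suc (trans (cong₂ _+_ (size-mirror r) (size-mirror l)) (+-comm (size r) (size l)))

leafFlag-mirror : ∀ t → leafFlag (mirror t) ≡ leafFlag t
leafFlag-mirror leaf       = refl
leafFlag-mirror (node _ _) = refl

-- Every leaf but a lone root is a left or a right child, and mirroring exchanges
-- the two kinds: left leaves of t and of its mirror add up to the size + 1 leaves.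
leftLeaves-mirror : ∀ t → leftLeaves t + leftLeaves (mirror t) + leafFlag t ≡ suc (size t)
leftLeaves-mirror leaf       = refl
leftLeaves-mirror (node l r) = begin
  (fl + Ll + Lr) + (leafFlag (mirror r) + Lr′ + Ll′) + 0
    ≡⟨ cong (λ f → (fl + Ll + Lr) + (f + Lr′ + Ll′) + 0) (leafFlag-mirror r) ⟩
  (fl + Ll + Lr) + (fr + Lr′ + Ll′) + 0
    ≡⟨ regroup fl Ll Lr fr Lr′ Ll′ ⟩
  (Ll + Ll′ + fl) + (Lr + Lr′ + fr)
    ≡⟨ cong₂ _+_ (leftLeaves-mirror l) (leftLeaves-mirror r) ⟩
  suc (size l) + suc (size r)
    ≡⟨ cong suc (+-suc (size l) (size r)) ⟩
  suc (size (node l r)) ∎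
  where
  fl : ℕ
  fl = leafFlag l
  fr : ℕ
  fr = leafFlag r
  Ll : ℕ
  Ll = leftLeaves l
  Lr : ℕ
  Lr = leftLeaves r
  Ll′ : ℕ
  Ll′ = leftLeaves (mirror l)
  Lr′ : ℕ
  Lr′ = leftLeaves (mirror r)
  regroup : ∀ fl Ll Lr fr Lr′ Ll′ →
            (fl + Ll + Lr) + (fr + Lr′ + Ll′) + 0 ≡ (Ll + Ll′ + fl) + (Lr + Lr′ + fr)
  regroup = solve-∀

mirror-leftLeaves : ∀ {n k} t → 1 ≤ n → size t ≡ n → leftLeaves t ≡ k →
                    size (mirror t) ≡ n × leftLeaves (mirror t) ≡ suc n ∸ k
mirror-leftLeaves (node l r) _ refl refl =
  size-mirror (node l r) ,
  (begin
    L′                     ≡⟨ sym (m+n∸m≡n L L′) ⟩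
    L + L′ ∸ L             ≡⟨ cong (_∸ L) (trans (sym (+-identityʳ (L + L′))) (leftLeaves-mirror (node l r))) ⟩
    suc (size (node l r)) ∸ L ∎)
  where
  L : ℕ
  L = leftLeaves (node l r)
  L′ : ℕ
  L′ = leftLeaves (mirror (node l r))

trees≤ : ℕ → List Tree
trees≤ zero    = [ leaf ]
trees≤ (suc n) = leaf ∷ cartesianProductWith node (trees≤ n) (trees≤ n)

∈-trees≤ : ∀ {n} t → size t ≤ n → t ∈ trees≤ n
∈-trees≤ {zero}  leaf       _        = here refl
∈-trees≤ {suc n} leaf       _        = here refl
∈-trees≤ {suc n} (node l r) (s≤s le) =
  there (∈-cartesianProductWith⁺ node (∈-trees≤ l (≤-trans (m≤m+n _ _) le))
                                      (∈-trees≤ r (≤-trans (m≤n+m _ _) le)))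

trees≤-unique : ∀ n → Unique (trees≤ n)
trees≤-unique zero    = All.[] ∷ []
trees≤-unique (suc n) =
  All.tabulate leaf-once ∷ cartesianProductWith⁺ node node-injective (trees≤-unique n) (trees≤-unique n)
  where
  node-injective : ∀ {l l' r r'} → node l r ≡ node l' r' → l ≡ l' × r ≡ r'
  node-injective refl = refl , refl
  leaf-once : ∀ {t} → t ∈ cartesianProductWith node (trees≤ n) (trees≤ n) → leaf ≢ t
  leaf-once t∈ refl with ∈-cartesianProductWith⁻ node (trees≤ n) (trees≤ n) t∈
  ... | _ , _ , _ , _ , ()

words-suc : ∀ n m → words (suc n) m ≡ cartesianProductWith (λ w a → a ∷ w) (words n m) (upTo m)
words-suc n m = go (words n m)
  where
  go : ∀ ws → concatMap (λ w → map (_∷ w) (upTo m)) ws ≡ cartesianProductWith (λ w a → a ∷ w) ws (upTo m)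
  go []       = refl
  go (w ∷ ws) = cong (map (_∷ w) (upTo m) ++_) (go ws)

words-unique : ∀ n m → Unique (words n m)
words-unique zero    m = All.[] ∷ []
words-unique (suc n) m rewrite words-suc n m =
  cartesianProductWith⁺ (λ w a → a ∷ w) (swap ∘ ∷-injective) (words-unique n m) (upTo⁺ m)

∈-words : ∀ n m w → length w ≡ n → (∀ {x} → x ∈ w → x < m) → w ∈ words n m
∈-words zero    m []      refl _       = here refl
∈-words (suc n) m (a ∷ w) refl letters rewrite words-suc n m =
  ∈-cartesianProductWith⁺ (λ w a → a ∷ w) (∈-words n m w refl (letters ∘ there)) (∈-upTo⁺ (letters (here refl)))

words-letters : ∀ n m {w x} → w ∈ words n m → x ∈ w → x < m
words-letters zero    m (here refl) ()
words-letters (suc n) m w∈ x∈ rewrite words-suc n m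
  with ∈-cartesianProductWith⁻ (λ w a → a ∷ w) (words n m) (upTo m) w∈
... | w′ , a , w′∈ , a∈ , refl with x∈
...   | here refl = ∈-upTo⁻ a∈
...   | there x∈w′ = words-letters n m w′∈ x∈w′

distinct⇒unique : ∀ w → T (distinct w) → Unique w
distinct⇒unique []       _ = []
distinct⇒unique (x ∷ xs) t with Equivalence.to T-∧ t
... | x-new , rest =
  All.tabulate (λ y∈ x≡y → subst T (any-false⁻ (Equivalence.to T-not-≡ x-new) y∈) (≡⇒≡ᵇ _ _ x≡y))
  ∷ distinct⇒unique xs rest

unique⇒distinct : ∀ w → Unique w → T (distinct w)
unique⇒distinct []       _          = tt
unique⇒distinct (x ∷ xs) (x∉ ∷ u) =
  Equivalence.from T-∧
    ( Equivalence.from T-not-≡ (any-false⁺ _ xs (λ y∈ → refute (≡ᵇ⇒≡ x _) (All.lookup x∉ y∈)))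
    , unique⇒distinct xs u)

counted : ℕ → ℕ → List ℕ → Bool
counted n k σ = isPerm n σ ∧ not (contains132 σ) ∧ (mmp σ ≡ᵇ k)

counted⁺ : ∀ {n k σ} → Arrangement 0 n σ → Avoids132 σ → mmp σ ≡ k →
           σ ∈ words n n × T (counted n k σ)
counted⁺ {n} {k} {σ} arr av mm =
  ∈-words n n σ length≡ (proj₂ ∘ inRange) ,
  Equivalence.from T-∧ (Equivalence.from T-∧ (≡⇒≡ᵇ _ _ length≡ , unique⇒distinct σ unique) ,
                        Equivalence.from T-∧ (Equivalence.from T-not-≡ av , ≡⇒≡ᵇ _ _ mm))
  where open Arrangement arr

counted⁻ : ∀ {n k σ} → σ ∈ words n n → T (counted n k σ) →
           Arrangement 0 n σ × Avoids132 σ × mmp σ ≡ k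
counted⁻ {n} {k} {σ} σ∈ c with Equivalence.to T-∧ c
... | perm , rest with Equivalence.to T-∧ perm | Equivalence.to T-∧ rest
...   | len , dist | av , mm =
  record { length≡ = ≡ᵇ⇒≡ _ _ len ; unique = distinct⇒unique σ dist
         ; inRange = λ x∈ → z≤n , words-letters n n σ∈ x∈ } ,
  Equivalence.to T-not-≡ av , ≡ᵇ⇒≡ _ _ mm

shape : ℕ → ℕ → Tree → Bool
shape n k t = (size t ≡ᵇ n) ∧ (leftLeaves t ≡ᵇ k)

shape⁺ : ∀ {n k} t → size t ≡ n → leftLeaves t ≡ k → t ∈ trees≤ n × T (shape n k t)
shape⁺ t refl refl =
  ∈-trees≤ t ≤-refl , Equivalence.from T-∧ (≡⇒≡ᵇ (size t) _ refl , ≡⇒≡ᵇ (leftLeaves t) _ refl)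

shape⁻ : ∀ {n k} t → T (shape n k t) → size t ≡ n × leftLeaves t ≡ k
shape⁻ t sh with Equivalence.to T-∧ sh
... | s , l = ≡ᵇ⇒≡ _ _ s , ≡ᵇ⇒≡ _ _ l

treeCount : ℕ → ℕ → ℕ
treeCount n k = length (filterᵇ (shape n k) (trees≤ n))

treeCount≡coeffQ : ∀ n k → treeCount n k ≡ coeffQ n k
treeCount≡coeffQ n k =
  count-bijection (λ t → decode t 0) (decode-injective _ _ 0) (trees≤-unique n) (words-unique n n) into onto
  where
  into : ∀ {t} → t ∈ trees≤ n → T (shape n k t) → decode t 0 ∈ words n n × T (counted n k (decode t 0))
  into {t} _ sh with shape⁻ t sh
  ... | refl , leaves = counted⁺ (decode-arrangement t 0) (decode-avoids t 0) (trans (lrmin-decode t 0) leaves)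
  onto : ∀ {σ} → σ ∈ words n n → T (counted n k σ) → ∃[ t ] (t ∈ trees≤ n × T (shape n k t) × decode t 0 ≡ σ)
  onto σ∈ c with counted⁻ σ∈ c
  ... | arr , av , mm with encode n n 0 _ ≤-refl arr av
  ...   | t , size≡ , refl with shape⁺ t size≡ (trans (sym (lrmin-decode t 0)) mm)
  ...     | t∈ , sh = t , t∈ , sh , refl

treeCount-mirror : ∀ n k → 1 ≤ n → k ≤ suc n → treeCount n k ≡ treeCount n (suc n ∸ k)
treeCount-mirror n k 1≤n k≤ = count-bijection mirror mirror-injective (trees≤-unique n) (trees≤-unique n) into onto
  where
  into : ∀ {t} → t ∈ trees≤ n → T (shape n k t) → mirror t ∈ trees≤ n × T (shape n (suc n ∸ k) (mirror t))
  into {t} _ sh with shape⁻ t sh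
  ... | s , l = uncurry (shape⁺ (mirror t)) (mirror-leftLeaves t 1≤n s l)
  onto : ∀ {t} → t ∈ trees≤ n → T (shape n (suc n ∸ k) t) →
         ∃[ t′ ] (t′ ∈ trees≤ n × T (shape n k t′) × mirror t′ ≡ t)
  onto {t} _ sh with shape⁻ t sh
  ... | s , l with mirror-leftLeaves t 1≤n s l
  ...   | s′ , l′ with shape⁺ (mirror t) s′ (trans l′ (m∸[m∸n]≡n k≤))
  ...     | t′∈ , sh′ = mirror t , t′∈ , sh′ , mirror-involutive t

theorem25 : (n : ℕ) → 1 ≤ n → (k : ℕ) → k ≤ suc n →
    coeffQ n k ≡ coeffQ n (suc n ∸ k)
theorem25 n 1≤n k k≤ = begin
  coeffQ n k              ≡⟨ sym (treeCount≡coeffQ n k) ⟩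
  treeCount n k           ≡⟨ treeCount-mirror n k 1≤n k≤ ⟩
  treeCount n (suc n ∸ k) ≡⟨ treeCount≡coeffQ n (suc n ∸ k) ⟩
  coeffQ n (suc n ∸ k)    ∎
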